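{- For each integer $n$ with $1\le n\le 8$, except possibly $n=3$, we have $\delta(n)>\delta(n-1)$.
   Context: Two points $x\neq y$ of $\mathbb{Z}^2$ are neighbors if $|x_i-y_i|\le 1$ for $i=1,2$. For $S\subseteq\mathbb{Z}^2$, $N_S(x)$ is the number of neighbors of $x$ in $S$. Let ${\sf B}_r=\{x\in\mathbb{Z}^2:|x_1|,|x_2|<r\}$; the upper density of $S$ is $\limsup_{r\to\infty}|{\sf B}_r\cap S|/|{\sf B}_r|$. $\delta(n)$ is the supremum of upper densities of sets $S\subseteq\mathbb{Z}^2$ with $N_S(x)\le n$ for all $x\in S$. -}

module Defs where

open import Data.Bool using (Bool; true; false; if_then_else_)
open import Data.Nat as ℕ using (ℕ; suc; _≤_)
open import Data.Integer as ℤ using (ℤ; +_; -[1+_])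
open import Data.List using (List; []; _∷_; map; upTo; concatMap)
open import Data.Nat.ListAction using (sum)
open import Data.Product using (_×_; _,_; ∃; ∃-syntax; Σ-syntax)
open import Data.Rational as ℚ using (ℚ; Positive)
open import Relation.Binary.PropositionalEquality using (_≡_)

Subset : Set
Subset = ℤ → ℤ → Bool

indicator : Bool → ℕ
indicator true  = 1
indicator false = 0

offsets : List (ℤ × ℤ)
offsets =
  (-[1+ 0 ] , -[1+ 0 ]) ∷ (-[1+ 0 ] , + 0) ∷ (-[1+ 0 ] , + 1) ∷
  (+ 0 , -[1+ 0 ]) ∷ (+ 0 , + 1) ∷
  (+ 1 , -[1+ 0 ]) ∷ (+ 1 , + 0) ∷ (+ 1 , + 1) ∷ []

N : Subset → ℤ → ℤ → ℕ
N S x₁ x₂ = sum (map (λ { (d₁ , d₂) → indicator (S (x₁ ℤ.+ d₁) (x₂ ℤ.+ d₂)) }) offsets)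

Admissible : ℕ → Subset → Set
Admissible n S = ∀ x₁ x₂ → S x₁ x₂ ≡ true → N S x₁ x₂ ≤ n

range : ℕ → List ℤ
range k = map (λ i → + i ℤ.- + k) (upTo (suc (2 ℕ.* k)))

-- |B_{k+1} ∩ S|, where B_{k+1} = {x : |x₁|,|x₂| < k+1} = [-k,k]².
count : Subset → ℕ → ℕ
count S k = sum (concatMap (λ x₁ → map (λ x₂ → indicator (S x₁ x₂)) (range k)) (range k))

side : ℕ → ℕ
side k = suc (2 ℕ.* k)

density : Subset → ℕ → ℚ
density S k = (+ count S k) ℚ./ (side k ℕ.* side k)

-- upper density of S (limsup over r = k+1 → ∞) is > q
UpperDensity> : Subset → ℚ → Set
UpperDensity> S q = ∃[ ε ] (Positive ε × (∀ R → ∃[ k ] (R ≤ k × q ℚ.+ ε ℚ.≤ density S k)))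

UpperDensity≤ : Subset → ℚ → Set
UpperDensity≤ S q = ∀ ε → Positive ε → ∃[ R ] (∀ k → R ≤ k → density S k ℚ.≤ q ℚ.+ ε)

-- δ(n) > δ(m), where δ(n) = sup of upper densities of admissible sets:
-- some rational q lies (weakly) above every upper density for m and strictly
-- below the upper density of some set admissible for n.
δ>δ : ℕ → ℕ → Set
δ>δ n m = ∃[ q ] ((∃[ S ] (Admissible n S × UpperDensity> S q))
                  × (∀ T → Admissible m T → UpperDensity≤ T q))

module Submission where

-- For each n a rational K/C separates δ(n-1) from δ(n).
--
-- Lower bound: a periodic set, checked to be admissible for n on one period, has at least c₀ points
-- in every a×b window. Summing the window counts over a box counts every point of the set ab times,
-- up to a boundary term, so its upper density is at least c₀/(ab) > K/C.
--
-- Upper bound, by discharging: every point of a set X admissible for n-1 starts with charge C and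
-- sends one unit to each of its neighbours outside X. A check of all 2⁹ configurations of a 3×3
-- window, using only the admissibility visible inside the window, shows that every point ends with
-- charge at most K. Charge is conserved up to a boundary term, so C·|B ∩ X| ≤ K·|B| + O(side B).
-- For n = 1 a 2×2 block holds at most one point of a set without neighbours, so δ(0) ≤ 1/4.
--
-- All boundary terms come from translating a bounded function on ℤ², which changes its sum over the
-- box B_{k+1} by O(k), negligible against |B_{k+1}| = (2k+1)².

open import Defs

open import Data.Bool using (Bool; true; false; not; _∧_; _∨_; T)
open import Data.Bool.ListAction using (all)
open import Data.Bool.Properties using (T-≡; T-∧; ∧-comm)
open import Data.Fin using (Fin; zero; suc; toℕ; fromℕ; inject₁; lower₁)
open import Data.Fin.Properties using (toℕ-fromℕ; toℕ-inject₁-≢; lower₁-inject₁′; inject₁-lower₁; toℕ-injective; all?)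
open import Data.Integer as ℤ using (ℤ; -[1+_]; 0ℤ)
import Data.Integer.Properties as ℤ
open import Data.List using (List; []; _∷_; map; length; applyUpTo; upTo; concatMap)
open import Data.List.Properties using (map-∘; map-cong)
open import Data.List.Relation.Unary.All as All using (All; []; _∷_)
open import Data.List.Relation.Unary.All.Properties using (all⁻)
open import Data.Nat as ℕ using (ℕ; zero; suc; _+_; _*_; _∸_; _≤_; _<_; _≤?_; _<?_; _≤ᵇ_; z≤n; s≤s; ∣_-_∣; _⊔_; NonZero)
open import Data.Nat.ListAction using (sum)
open import Data.Nat.ListAction.Properties using (sum-++)
open import Data.Nat.Properties
open import Data.Nat.Tactic.RingSolver using (solve-∀)
open import Data.Product using (_×_; _,_; proj₁; proj₂)
open import Data.Rational as ℚ using (mkℚ; _/_; toℚᵘ)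
import Data.Rational.Properties as ℚ
open import Data.Rational.Unnormalised as ℚᵘ using (mkℚᵘ; *≤*)
import Data.Rational.Unnormalised.Properties as ℚᵘ
open import Data.Unit using (tt)
open import Data.Vec using (Vec; []; _∷_; lookup)
open import Function using (_∘_; id)
open import Function.Bundles using (Equivalence)
open import Relation.Binary.PropositionalEquality
open import Relation.Nullary using (contradiction; yes; no)
open import Relation.Nullary.Decidable using (Dec; map′; _×-dec_; _→-dec_; T?; from-yes; from-no)
open import Relation.Unary using (Decidable)

open import Algebra.Properties.CommutativeSemigroup +-commutativeSemigroup using (interchange)

-- Finite sums

∣a+b-c+d∣≤∣a-c∣+∣b-d∣ : ∀ a b c d → ∣ a + b - c + d ∣ ≤ ∣ a - c ∣ + ∣ b - d ∣
∣a+b-c+d∣≤∣a-c∣+∣b-d∣ a b c d = begin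
  ∣ a + b - c + d ∣                     ≤⟨ ∣-∣-triangle (a + b) (c + b) (c + d) ⟩
  ∣ a + b - c + b ∣ + ∣ c + b - c + d ∣ ≡⟨ cong₂ _+_ cancel-b (∣m+n-m+o∣≡∣n-o∣ c b d) ⟩
  ∣ a - c ∣ + ∣ b - d ∣                 ∎
  where
  open ≤-Reasoning
  cancel-b : ∣ a + b - c + b ∣ ≡ ∣ a - c ∣
  cancel-b = trans (cong₂ ∣_-_∣ (+-comm a b) (+-comm c b)) (∣m+n-m+o∣≡∣n-o∣ b a c)

a+p≡b+q⇒∣a-b∣≡∣q-p∣ : ∀ a b {p q} → a + p ≡ b + q → ∣ a - b ∣ ≡ ∣ q - p ∣
a+p≡b+q⇒∣a-b∣≡∣q-p∣ a b {p} {q} eq = begin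
  ∣ a - b ∣         ≡⟨ ∣m+n-m+o∣≡∣n-o∣ p a b ⟨
  ∣ p + a - p + b ∣ ≡⟨ cong₂ ∣_-_∣ (trans (+-comm p a) eq) (+-comm p b) ⟩
  ∣ b + q - b + p ∣ ≡⟨ ∣m+n-m+o∣≡∣n-o∣ b q p ⟩
  ∣ q - p ∣         ∎
  where open ≡-Reasoning

∑ : ℕ → (ℕ → ℕ) → ℕ
∑ zero    f = 0
∑ (suc n) f = f 0 + ∑ n (f ∘ suc)

infix 5 ∑
syntax ∑ n (λ i → e) = ∑[ i < n ] e

∑-cong : ∀ n {f g : ℕ → ℕ} → (∀ i → f i ≡ g i) → ∑ n f ≡ ∑ n g
∑-cong zero    f≗g = refl
∑-cong (suc n) f≗g = cong₂ _+_ (f≗g 0) (∑-cong n (f≗g ∘ suc))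

∑-mono : ∀ n {f g : ℕ → ℕ} → (∀ i → i < n → f i ≤ g i) → ∑ n f ≤ ∑ n g
∑-mono zero    f≤g = z≤n
∑-mono (suc n) f≤g = +-mono-≤ (f≤g 0 (s≤s z≤n)) (∑-mono n (λ i i<n → f≤g (suc i) (s≤s i<n)))

∑-distrib-+ : ∀ n (f g : ℕ → ℕ) → ∑[ i < n ] (f i + g i) ≡ ∑ n f + ∑ n g
∑-distrib-+ zero    f g = refl
∑-distrib-+ (suc n) f g =
  trans (cong ((f 0 + g 0) +_) (∑-distrib-+ n (f ∘ suc) (g ∘ suc))) (interchange (f 0) (g 0) _ _)

∑-const : ∀ n c → ∑[ i < n ] c ≡ n * c
∑-const zero    c = refl
∑-const (suc n) c = cong (c +_) (∑-const n c)

∑∑-const : ∀ m n c → ∑[ i < m ] ∑[ j < n ] c ≡ m * (n * c)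
∑∑-const m n c = trans (∑-cong m (λ _ → ∑-const n c)) (∑-const m (n * c))

*-distribˡ-∑ : ∀ n c (f : ℕ → ℕ) → c * ∑ n f ≡ ∑[ i < n ] c * f i
*-distribˡ-∑ zero    c f = *-zeroʳ c
*-distribˡ-∑ (suc n) c f = trans (*-distribˡ-+ c (f 0) _) (cong (c * f 0 +_) (*-distribˡ-∑ n c (f ∘ suc)))

∑-comm : ∀ m n (f : ℕ → ℕ → ℕ) → ∑[ i < m ] ∑[ j < n ] f i j ≡ ∑[ j < n ] ∑[ i < m ] f i j
∑-comm zero    n f = sym (trans (∑-const n 0) (*-zeroʳ n))
∑-comm (suc m) n f = trans (cong (∑ n (f 0) +_) (∑-comm m n (f ∘ suc)))
                           (sym (∑-distrib-+ n (f 0) (λ j → ∑[ i < m ] f (suc i) j)))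

∑-suc : ∀ n (f : ℕ → ℕ) → ∑ (suc n) f ≡ ∑ n f + f n
∑-suc zero    f = +-comm (f 0) 0
∑-suc (suc n) f = trans (cong (f 0 +_) (∑-suc n (f ∘ suc))) (sym (+-assoc (f 0) _ _))

∑-∣-∣ : ∀ n (f g : ℕ → ℕ) → ∣ ∑ n f - ∑ n g ∣ ≤ ∑[ i < n ] ∣ f i - g i ∣
∑-∣-∣ zero    f g = z≤n
∑-∣-∣ (suc n) f g =
  ≤-trans (∣a+b-c+d∣≤∣a-c∣+∣b-d∣ (f 0) _ (g 0) _) (+-monoʳ-≤ _ (∑-∣-∣ n (f ∘ suc) (g ∘ suc)))

∑-shift-suc : ∀ n {f : ℕ → ℕ} {b} → (∀ i → f i ≤ b) → ∣ ∑[ i < n ] f (suc i) - ∑ n f ∣ ≤ b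
∑-shift-suc n {f} {b} f≤b = begin
  ∣ ∑ n (f ∘ suc) - ∑ n f ∣ ≡⟨ a+p≡b+q⇒∣a-b∣≡∣q-p∣ (∑ n (f ∘ suc)) (∑ n f) both-ends ⟩
  ∣ f n - f 0 ∣             ≤⟨ ∣m-n∣≤m⊔n (f n) (f 0) ⟩
  f n ⊔ f 0                 ≤⟨ ⊔-lub (f≤b n) (f≤b 0) ⟩
  b                         ∎
  where
  open ≤-Reasoning
  both-ends : ∑ n (f ∘ suc) + f 0 ≡ ∑ n f + f n
  both-ends = trans (+-comm _ (f 0)) (∑-suc n f)

∑-shift : ∀ n {f : ℕ → ℕ} {b} → (∀ i → f i ≤ b) → ∀ u → ∣ ∑[ i < n ] f (i + u) - ∑ n f ∣ ≤ u * b
∑-shift n {f} f≤b zero = ≤-reflexive (m≡n⇒∣m-n∣≡0 (∑-cong n (cong f ∘ +-identityʳ)))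
∑-shift n {f} {b} f≤b (suc u) = begin
  ∣ ∑[ i < n ] f (i + suc u) - ∑ n f ∣
    ≡⟨ cong (∣_- ∑ n f ∣) (∑-cong n (λ i → cong f (+-suc i u))) ⟩
  ∣ ∑[ i < n ] f (suc i + u) - ∑ n f ∣
    ≤⟨ ∣-∣-triangle (∑[ i < n ] f (suc i + u)) (∑[ i < n ] f (i + u)) (∑ n f) ⟩
  ∣ ∑[ i < n ] f (suc i + u) - ∑[ i < n ] f (i + u) ∣ + ∣ ∑[ i < n ] f (i + u) - ∑ n f ∣
    ≤⟨ +-mono-≤ (∑-shift-suc n (λ i → f≤b (i + u))) (∑-shift n f≤b u) ⟩
  b + u * b ∎
  where open ≤-Reasoning

sum-map-applyUpTo : ∀ {A : Set} n (g : A → ℕ) (h : ℕ → A) → sum (map g (applyUpTo h n)) ≡ ∑[ i < n ] g (h i)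
sum-map-applyUpTo zero    g h = refl
sum-map-applyUpTo (suc n) g h = cong (g (h 0) +_) (sum-map-applyUpTo n g (h ∘ suc))

sum-concatMap : ∀ {A : Set} (f : A → List ℕ) xs → sum (concatMap f xs) ≡ sum (map (sum ∘ f) xs)
sum-concatMap f []       = refl
sum-concatMap f (x ∷ xs) = trans (sum-++ (f x) (concatMap f xs)) (cong (sum (f x) +_) (sum-concatMap f xs))

sum-map-mono : ∀ {A : Set} {f g : A → ℕ} {xs} → All (λ a → f a ≤ g a) xs → sum (map f xs) ≤ sum (map g xs)
sum-map-mono []           = z≤n
sum-map-mono (fa≤ga ∷ ps) = +-mono-≤ fa≤ga (sum-map-mono ps)

sum-map-distrib-+ : ∀ {A : Set} (f g : A → ℕ) xs → sum (map (λ a → f a + g a) xs) ≡ sum (map f xs) + sum (map g xs)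
sum-map-distrib-+ f g []       = refl
sum-map-distrib-+ f g (a ∷ xs) = trans (cong ((f a + g a) +_) (sum-map-distrib-+ f g xs)) (interchange (f a) (g a) _ _)

sum-map-const : ∀ {A : Set} c (xs : List A) → sum (map (λ _ → c) xs) ≡ length xs * c
sum-map-const c []       = refl
sum-map-const c (a ∷ xs) = cong (c +_) (sum-map-const c xs)

-- Sums over the boxes B_{k+1}

x+d-d≡x : ∀ x d → x ℤ.+ d ℤ.- d ≡ x
x+d-d≡x x d = trans (ℤ.+-assoc x d (ℤ.- d)) (trans (cong (ℤ._+_ x) (ℤ.+-inverseʳ d)) (ℤ.+-identityʳ x))

x-d+d≡x : ∀ x d → x ℤ.- d ℤ.+ d ≡ x
x-d+d≡x x d = trans (ℤ.+-assoc x (ℤ.- d) d) (trans (cong (ℤ._+_ x) (ℤ.+-inverseˡ d)) (ℤ.+-identityʳ x))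

coord : ℕ → ℕ → ℤ
coord k i = ℤ.+ i ℤ.- ℤ.+ k

rangeSum : ℕ → (ℤ → ℕ) → ℕ
rangeSum k F = ∑[ i < side k ] F (coord k i)

boxSum : ℕ → (ℤ → ℤ → ℕ) → ℕ
boxSum k g = rangeSum k (λ x → rangeSum k (g x))

sum-map-range : ∀ k F → sum (map F (range k)) ≡ rangeSum k F
sum-map-range k F = trans (cong sum (sym (map-∘ (upTo (side k))))) (sum-map-applyUpTo (side k) (F ∘ coord k) id)

count≡boxSum : ∀ S k → count S k ≡ boxSum k (λ x y → indicator (S x y))
count≡boxSum S k = begin
  count S k                            ≡⟨ sum-concatMap row (range k) ⟩
  sum (map (sum ∘ row) (range k))      ≡⟨ sum-map-range k (sum ∘ row) ⟩
  rangeSum k (sum ∘ row)               ≡⟨ ∑-cong (side k) (λ i → sum-map-range k (λ y → indicator (S (coord k i) y))) ⟩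
  boxSum k (λ x y → indicator (S x y)) ∎
  where
  open ≡-Reasoning
  row : ℤ → List ℕ
  row x = map (λ y → indicator (S x y)) (range k)

module _ (k : ℕ) where

  boxSum-cong : ∀ {g h : ℤ → ℤ → ℕ} → (∀ x y → g x y ≡ h x y) → boxSum k g ≡ boxSum k h
  boxSum-cong g≗h = ∑-cong (side k) (λ i → ∑-cong (side k) (λ j → g≗h (coord k i) (coord k j)))

  boxSum-mono : ∀ {g h : ℤ → ℤ → ℕ} → (∀ x y → g x y ≤ h x y) → boxSum k g ≤ boxSum k h
  boxSum-mono g≤h = ∑-mono (side k) (λ i _ → ∑-mono (side k) (λ j _ → g≤h (coord k i) (coord k j)))

  boxSum-distrib-+ : ∀ (g h : ℤ → ℤ → ℕ) → boxSum k (λ x y → g x y + h x y) ≡ boxSum k g + boxSum k h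
  boxSum-distrib-+ g h =
    trans (∑-cong (side k) (λ i → ∑-distrib-+ (side k) (g (coord k i) ∘ coord k) (h (coord k i) ∘ coord k)))
          (∑-distrib-+ (side k) (λ i → rangeSum k (g (coord k i))) (λ i → rangeSum k (h (coord k i))))

  boxSum-const : ∀ c → boxSum k (λ _ _ → c) ≡ c * (side k * side k)
  boxSum-const c =
    trans (∑∑-const (side k) (side k) c) (trans (sym (*-assoc (side k) (side k) c)) (*-comm (side k * side k) c))

  *-distribˡ-boxSum : ∀ c (g : ℤ → ℤ → ℕ) → c * boxSum k g ≡ boxSum k (λ x y → c * g x y)
  *-distribˡ-boxSum c g =
    trans (*-distribˡ-∑ (side k) c (λ i → rangeSum k (g (coord k i))))
          (∑-cong (side k) (λ i → *-distribˡ-∑ (side k) c (g (coord k i) ∘ coord k)))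

  boxSum-∑ : ∀ n (F : ℕ → ℤ → ℤ → ℕ) → boxSum k (λ x y → ∑[ u < n ] F u x y) ≡ ∑[ u < n ] boxSum k (F u)
  boxSum-∑ n F =
    trans (∑-cong (side k) (λ i → ∑-comm (side k) n (λ j u → F u (coord k i) (coord k j))))
          (∑-comm (side k) n (λ i u → rangeSum k (F u (coord k i))))

  boxSum-sum : ∀ {A : Set} (xs : List A) (F : A → ℤ → ℤ → ℕ) →
               boxSum k (λ x y → sum (map (λ a → F a x y) xs)) ≡ sum (map (λ a → boxSum k (F a)) xs)
  boxSum-sum []       F = boxSum-const 0
  boxSum-sum (a ∷ xs) F =
    trans (boxSum-distrib-+ (F a) (λ x y → sum (map (λ a → F a x y) xs))) (cong (boxSum k (F a) +_) (boxSum-sum xs F))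

  rangeSum-bound : ∀ {F : ℤ → ℕ} {b} → (∀ x → F x ≤ b) → rangeSum k F ≤ side k * b
  rangeSum-bound {b = b} F≤b = ≤-trans (∑-mono (side k) (λ i _ → F≤b (coord k i))) (≤-reflexive (∑-const (side k) b))

  coord-+ : ∀ i u → coord k i ℤ.+ ℤ.+ u ≡ coord k (i + u)
  coord-+ i u = begin
    ℤ.+ i ℤ.- ℤ.+ k ℤ.+ ℤ.+ u       ≡⟨ ℤ.+-assoc (ℤ.+ i) (ℤ.- ℤ.+ k) (ℤ.+ u) ⟩
    ℤ.+ i ℤ.+ (ℤ.- ℤ.+ k ℤ.+ ℤ.+ u) ≡⟨ cong (ℤ._+_ (ℤ.+ i)) (ℤ.+-comm (ℤ.- ℤ.+ k) (ℤ.+ u)) ⟩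
    ℤ.+ i ℤ.+ (ℤ.+ u ℤ.- ℤ.+ k)     ≡⟨ ℤ.+-assoc (ℤ.+ i) (ℤ.+ u) (ℤ.- ℤ.+ k) ⟨
    coord k (i + u)                 ∎
    where open ≡-Reasoning

  rangeSum-shift : ∀ {F : ℤ → ℕ} {b} → (∀ x → F x ≤ b) → ∀ d →
                   ∣ rangeSum k (λ x → F (x ℤ.+ d)) - rangeSum k F ∣ ≤ ℤ.∣ d ∣ * b
  rangeSum-shift {F} {b} F≤b (ℤ.+ u) = begin
    ∣ rangeSum k (λ x → F (x ℤ.+ ℤ.+ u)) - rangeSum k F ∣
      ≡⟨ cong (∣_- rangeSum k F ∣) (∑-cong (side k) (λ i → cong F (coord-+ i u))) ⟩
    ∣ ∑[ i < side k ] F (coord k (i + u)) - rangeSum k F ∣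
      ≤⟨ ∑-shift (side k) (F≤b ∘ coord k) u ⟩
    u * b ∎
    where open ≤-Reasoning
  rangeSum-shift {F} {b} F≤b -[1+ u ] = begin
    ∣ rangeSum k G - rangeSum k F ∣
      ≡⟨ cong (∣ rangeSum k G -_∣) (∑-cong (side k) G-back) ⟩
    ∣ rangeSum k G - ∑[ i < side k ] G (coord k (i + suc u)) ∣
      ≡⟨ ∣-∣-comm (rangeSum k G) _ ⟩
    ∣ ∑[ i < side k ] G (coord k (i + suc u)) - rangeSum k G ∣
      ≤⟨ ∑-shift (side k) (λ i → F≤b (coord k i ℤ.+ -[1+ u ])) (suc u) ⟩
    suc u * b ∎
    where
    open ≤-Reasoning
    G : ℤ → ℕ
    G x = F (x ℤ.+ -[1+ u ])
    G-back : ∀ i → F (coord k i) ≡ G (coord k (i + suc u))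
    G-back i = cong F (sym (trans (cong (ℤ._+ -[1+ u ]) (sym (coord-+ i (suc u)))) (x+d-d≡x (coord k i) (ℤ.+ suc u))))

  boxSum-shift : ∀ {g : ℤ → ℤ → ℕ} {b} → (∀ x y → g x y ≤ b) → ∀ d₁ d₂ →
                 ∣ boxSum k (λ x y → g (x ℤ.+ d₁) (y ℤ.+ d₂)) - boxSum k g ∣
                 ≤ (ℤ.∣ d₁ ∣ + ℤ.∣ d₂ ∣) * (side k * b)
  boxSum-shift {g} {b} g≤b d₁ d₂ = begin
    ∣ boxSum k g₁₂ - boxSum k g ∣
      ≤⟨ ∣-∣-triangle (boxSum k g₁₂) (boxSum k g₁) (boxSum k g) ⟩
    ∣ boxSum k g₁₂ - boxSum k g₁ ∣ + ∣ boxSum k g₁ - boxSum k g ∣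
      ≤⟨ +-mono-≤ inner outer ⟩
    side k * (ℤ.∣ d₂ ∣ * b) + ℤ.∣ d₁ ∣ * (side k * b)
      ≡⟨ regroup (side k) ℤ.∣ d₁ ∣ ℤ.∣ d₂ ∣ b ⟩
    (ℤ.∣ d₁ ∣ + ℤ.∣ d₂ ∣) * (side k * b) ∎
    where
    open ≤-Reasoning
    g₁ g₁₂ : ℤ → ℤ → ℕ
    g₁  x y = g (x ℤ.+ d₁) y
    g₁₂ x y = g (x ℤ.+ d₁) (y ℤ.+ d₂)
    regroup : ∀ s m n b → s * (n * b) + m * (s * b) ≡ (m + n) * (s * b)
    regroup = solve-∀
    inner : ∣ boxSum k g₁₂ - boxSum k g₁ ∣ ≤ side k * (ℤ.∣ d₂ ∣ * b)
    inner = begin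
      ∣ boxSum k g₁₂ - boxSum k g₁ ∣
        ≤⟨ ∑-∣-∣ (side k) (λ i → rangeSum k (g₁₂ (coord k i))) (λ i → rangeSum k (g₁ (coord k i))) ⟩
      ∑[ i < side k ] ∣ rangeSum k (g₁₂ (coord k i)) - rangeSum k (g₁ (coord k i)) ∣
        ≤⟨ ∑-mono (side k) (λ i _ → rangeSum-shift (g≤b (coord k i ℤ.+ d₁)) d₂) ⟩
      ∑[ i < side k ] ℤ.∣ d₂ ∣ * b
        ≡⟨ ∑-const (side k) (ℤ.∣ d₂ ∣ * b) ⟩
      side k * (ℤ.∣ d₂ ∣ * b) ∎
    outer : ∣ boxSum k g₁ - boxSum k g ∣ ≤ ℤ.∣ d₁ ∣ * (side k * b)
    outer = rangeSum-shift (λ x → rangeSum-bound (g≤b x)) d₁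

windowSum : ℕ → ℕ → (ℤ → ℤ → ℕ) → ℤ → ℤ → ℕ
windowSum a b g x y = ∑[ u < a ] ∑[ v < b ] g (x ℤ.+ ℤ.+ u) (y ℤ.+ ℤ.+ v)

boxSum-windowSum : ∀ k a b {g : ℤ → ℤ → ℕ} {c} → (∀ x y → g x y ≤ c) →
                   ∣ boxSum k (windowSum a b g) - a * (b * boxSum k g) ∣ ≤ a * (b * ((a + b) * (side k * c)))
boxSum-windowSum k a b {g} {c} g≤c = begin
  ∣ boxSum k (windowSum a b g) - a * (b * boxSum k g) ∣
    ≡⟨ cong₂ ∣_-_∣ split (sym (∑∑-const a b (boxSum k g))) ⟩
  ∣ ∑[ u < a ] ∑[ v < b ] boxSum k (shifted u v) - ∑[ u < a ] ∑[ v < b ] boxSum k g ∣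
    ≤⟨ ∑-∣-∣ a _ _ ⟩
  ∑[ u < a ] ∣ ∑[ v < b ] boxSum k (shifted u v) - ∑[ v < b ] boxSum k g ∣
    ≤⟨ ∑-mono a (λ u u<a → ≤-trans (∑-∣-∣ b _ _) (∑-mono b (λ v v<b → shift-error u v u<a v<b))) ⟩
  ∑[ u < a ] ∑[ v < b ] (a + b) * (side k * c)
    ≡⟨ ∑∑-const a b _ ⟩
  a * (b * ((a + b) * (side k * c))) ∎
  where
  open ≤-Reasoning
  shifted : ℕ → ℕ → ℤ → ℤ → ℕ
  shifted u v x y = g (x ℤ.+ ℤ.+ u) (y ℤ.+ ℤ.+ v)
  split : boxSum k (windowSum a b g) ≡ ∑[ u < a ] ∑[ v < b ] boxSum k (shifted u v)
  split = trans (boxSum-∑ k a (λ u x y → ∑[ v < b ] shifted u v x y)) (∑-cong a (λ u → boxSum-∑ k b (shifted u)))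
  shift-error : ∀ u v → u < a → v < b → ∣ boxSum k (shifted u v) - boxSum k g ∣ ≤ (a + b) * (side k * c)
  shift-error u v u<a v<b = ≤-trans (boxSum-shift k g≤c (ℤ.+ u) (ℤ.+ v)) (*-monoˡ-≤ _ (+-mono-≤ (<⇒≤ u<a) (<⇒≤ v<b)))

indicator≤1 : ∀ b → indicator b ≤ 1
indicator≤1 true  = ≤-refl
indicator≤1 false = z≤n

indicator-mono : ∀ {a b} → (T a → T b) → indicator a ≤ indicator b
indicator-mono {false}         _   = z≤n
indicator-mono {true}  {true}  _   = ≤-refl
indicator-mono {true}  {false} a⇒b = contradiction (a⇒b tt) λ ()

translate : Subset → ℤ → ℤ → Subset
translate X y₁ y₂ u v = X (y₁ ℤ.+ u) (y₂ ℤ.+ v)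

windowCount : ℕ → ℕ → Subset → ℕ
windowCount a b G = ∑[ u < a ] ∑[ v < b ] indicator (G (ℤ.+ u) (ℤ.+ v))

windowCount-cong : ∀ a b {G G′ : Subset} → (∀ u v → G u v ≡ G′ u v) → windowCount a b G ≡ windowCount a b G′
windowCount-cong a b G≗G′ = ∑-cong a (λ u → ∑-cong b (λ v → cong indicator (G≗G′ (ℤ.+ u) (ℤ.+ v))))

module _ (a b : ℕ) (X : Subset) (k : ℕ) where

  boxSum-windowCount : ∣ boxSum k (λ x y → windowCount a b (translate X x y)) - a * b * count X k ∣
                       ≤ a * (b * (a + b)) * side k
  boxSum-windowCount = begin
    ∣ boxSum k (windowSum a b I) - a * b * count X k ∣           ≡⟨ cong (∣ boxSum k (windowSum a b I) -_∣) abCount ⟩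
    ∣ boxSum k (windowSum a b I) - a * (b * boxSum k I) ∣        ≤⟨ boxSum-windowSum k a b (λ x y → indicator≤1 (X x y)) ⟩
    a * (b * ((a + b) * (side k * 1)))                          ≡⟨ regroup a b (side k) ⟩
    a * (b * (a + b)) * side k                                  ∎
    where
    open ≤-Reasoning
    I : ℤ → ℤ → ℕ
    I x y = indicator (X x y)
    abCount : a * b * count X k ≡ a * (b * boxSum k I)
    abCount = trans (*-assoc a b (count X k)) (cong (λ n → a * (b * n)) (count≡boxSum X k))
    regroup : ∀ a b s → a * (b * ((a + b) * (s * 1))) ≡ a * (b * (a + b)) * s
    regroup = solve-∀

  count-lower : ∀ {c₀} → (∀ x y → c₀ ≤ windowCount a b (translate X x y)) →
                c₀ * (side k * side k) ≤ a * b * count X k + a * (b * (a + b)) * side k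
  count-lower {c₀} dense = begin
    c₀ * (side k * side k)                     ≡⟨ boxSum-const k c₀ ⟨
    boxSum k (λ _ _ → c₀)                      ≤⟨ boxSum-mono k dense ⟩
    boxSum k W                                 ≤⟨ m≤n+∣m-n∣ (boxSum k W) (a * b * count X k) ⟩
    a * b * count X k + ∣ boxSum k W - a * b * count X k ∣ ≤⟨ +-monoʳ-≤ (a * b * count X k) boxSum-windowCount ⟩
    a * b * count X k + a * (b * (a + b)) * side k ∎
    where
    open ≤-Reasoning
    W : ℤ → ℤ → ℕ
    W x y = windowCount a b (translate X x y)

  count-upper : ∀ {c₁} → (∀ x y → windowCount a b (translate X x y) ≤ c₁) →
                a * b * count X k ≤ c₁ * (side k * side k) + a * (b * (a + b)) * side k
  count-upper {c₁} sparse = begin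
    a * b * count X k                                  ≤⟨ m≤∣m-n∣+n (a * b * count X k) (boxSum k W) ⟩
    ∣ a * b * count X k - boxSum k W ∣ + boxSum k W    ≡⟨ +-comm _ (boxSum k W) ⟩
    boxSum k W + ∣ a * b * count X k - boxSum k W ∣    ≡⟨ cong (boxSum k W +_) (∣-∣-comm (a * b * count X k) (boxSum k W)) ⟩
    boxSum k W + ∣ boxSum k W - a * b * count X k ∣    ≤⟨ +-mono-≤ (boxSum-mono k sparse) boxSum-windowCount ⟩
    boxSum k (λ _ _ → c₁) + a * (b * (a + b)) * side k ≡⟨ cong (_+ a * (b * (a + b)) * side k) (boxSum-const k c₁) ⟩
    c₁ * (side k * side k) + a * (b * (a + b)) * side k ∎
    where
    open ≤-Reasoning
    W : ℤ → ℤ → ℕ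
    W x y = windowCount a b (translate X x y)

N-cong : ∀ {S S′ : Subset} → (∀ u v → S u v ≡ S′ u v) → ∀ x₁ x₂ → N S x₁ x₂ ≡ N S′ x₁ x₂
N-cong S≗S′ x₁ x₂ = cong sum (map-cong (λ (d₁ , d₂) → cong indicator (S≗S′ (x₁ ℤ.+ d₁) (x₂ ℤ.+ d₂))) offsets)

N-mono : ∀ {S S′ : Subset} → (∀ u v → T (S u v) → T (S′ u v)) → ∀ x₁ x₂ → N S x₁ x₂ ≤ N S′ x₁ x₂
N-mono S⊆S′ x₁ x₂ =
  sum-map-mono (All.universal (λ (d₁ , d₂) → indicator-mono (S⊆S′ (x₁ ℤ.+ d₁) (x₂ ℤ.+ d₂))) offsets)

N-translate : ∀ X y₁ y₂ d₁ d₂ → N (translate X y₁ y₂) d₁ d₂ ≡ N X (y₁ ℤ.+ d₁) (y₂ ℤ.+ d₂)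
N-translate X y₁ y₂ d₁ d₂ = cong sum (map-cong (λ (e₁ , e₂) →
  cong₂ (λ u v → indicator (X u v)) (sym (ℤ.+-assoc y₁ d₁ e₁)) (sym (ℤ.+-assoc y₂ d₂ e₂))) offsets)

-- Exhaustive checks on the 3×3 window

_∩_ : Subset → Subset → Subset
(S ∩ S′) x y = S x y ∧ S′ x y

window : Subset
window u v = (ℤ.∣ u ∣ ≤ᵇ 1) ∧ (ℤ.∣ v ∣ ≤ᵇ 1)

windowPoints : List (ℤ × ℤ)
windowPoints = (0ℤ , 0ℤ) ∷ offsets

admissibleAt : ℕ → Subset → ℤ × ℤ → Bool
admissibleAt m G (d₁ , d₂) = not (G d₁ d₂) ∨ (N (window ∩ G) d₁ d₂ ≤ᵇ m)

locallyAdmissible : ℕ → Subset → Bool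
locallyAdmissible m G = all (admissibleAt m G) windowPoints

T-not-∨ : ∀ a {b} → (T a → T b) → T (not a ∨ b)
T-not-∨ true  a⇒b = a⇒b tt
T-not-∨ false _   = tt

admissible⇒locallyAdmissible : ∀ {m X} → Admissible m X → ∀ y₁ y₂ → T (locallyAdmissible m (translate X y₁ y₂))
admissible⇒locallyAdmissible {m} {X} adm y₁ y₂ = all⁻ (admissibleAt m G) (All.universal admissible-at windowPoints)
  where
  G = translate X y₁ y₂
  admissible-at : ∀ d → T (admissibleAt m G d)
  admissible-at (d₁ , d₂) = T-not-∨ (G d₁ d₂) λ d∈G → ≤⇒≤ᵇ (begin
    N (window ∩ G) d₁ d₂         ≤⟨ N-mono {window ∩ G} {G} (λ u v → proj₂ ∘ Equivalence.to (T-∧ {window u v})) d₁ d₂ ⟩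
    N G d₁ d₂                    ≡⟨ N-translate X y₁ y₂ d₁ d₂ ⟩
    N X (y₁ ℤ.+ d₁) (y₂ ℤ.+ d₂)  ≤⟨ adm _ _ (Equivalence.to T-≡ d∈G) ⟩
    m                            ∎)
    where open ≤-Reasoning

windowBits : Subset → Vec Bool 9
windowBits G = G ℤ.-1ℤ ℤ.-1ℤ ∷ G ℤ.-1ℤ 0ℤ ∷ G ℤ.-1ℤ ℤ.1ℤ
             ∷ G 0ℤ    ℤ.-1ℤ ∷ G 0ℤ    0ℤ ∷ G 0ℤ    ℤ.1ℤ
             ∷ G ℤ.1ℤ  ℤ.-1ℤ ∷ G ℤ.1ℤ  0ℤ ∷ G ℤ.1ℤ  ℤ.1ℤ ∷ []

fromBits : Vec Bool 9 → Subset
fromBits (b₁ ∷ b₂ ∷ b₃ ∷ b₄ ∷ b₅ ∷ b₆ ∷ b₇ ∷ b₈ ∷ b₉ ∷ []) = cells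
  where
  cells : Subset
  cells -[1+ 0 ] -[1+ 0 ] = b₁
  cells -[1+ 0 ] (ℤ.+ 0)  = b₂
  cells -[1+ 0 ] (ℤ.+ 1)  = b₃
  cells (ℤ.+ 0)  -[1+ 0 ] = b₄
  cells (ℤ.+ 0)  (ℤ.+ 0)  = b₅
  cells (ℤ.+ 0)  (ℤ.+ 1)  = b₆
  cells (ℤ.+ 1)  -[1+ 0 ] = b₇
  cells (ℤ.+ 1)  (ℤ.+ 0)  = b₈
  cells (ℤ.+ 1)  (ℤ.+ 1)  = b₉
  cells _        _        = false

-- A test Q that reads G only at the nine (literal) points of the window normalises to the same
-- boolean for G and for fromBits (windowBits G), so WindowLocal Q holds by refl.
WindowLocal : (Subset → Bool) → Set
WindowLocal Q = ∀ G → Q (fromBits (windowBits G)) ≡ Q G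

locallyAdmissible-windowLocal : ∀ m → WindowLocal (locallyAdmissible m)
locallyAdmissible-windowLocal m G = refl

∀-vec? : ∀ n {P : Vec Bool n → Set} → Decidable P → Dec (∀ v → P v)
∀-vec? zero    P? = map′ (λ { p [] → p }) (λ ∀P → ∀P []) (P? [])
∀-vec? (suc n) P? = map′ (λ { (∀P₁ , ∀P₀) (true ∷ v) → ∀P₁ v ; (∀P₁ , ∀P₀) (false ∷ v) → ∀P₀ v })
                         (λ ∀P → (λ v → ∀P (true ∷ v)) , (λ v → ∀P (false ∷ v)))
                         (∀-vec? n (P? ∘ (true ∷_)) ×-dec ∀-vec? n (P? ∘ (false ∷_)))

WindowCheck : ℕ → (Subset → Bool) → Set
WindowCheck m Q = ∀ v → T (locallyAdmissible m (fromBits v)) → T (Q (fromBits v))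

windowCheck? : ∀ m Q → Dec (WindowCheck m Q)
windowCheck? m Q = ∀-vec? 9 (λ v → T? (locallyAdmissible m (fromBits v)) →-dec T? (Q (fromBits v)))

windowCheck-sound : ∀ {m} Q → WindowLocal Q → WindowCheck m Q →
                    ∀ {X} → Admissible m X → ∀ y₁ y₂ → T (Q (translate X y₁ y₂))
windowCheck-sound {m} Q Q-local check {X} adm y₁ y₂ =
  subst T (Q-local G) (check (windowBits G) (subst T (sym (locallyAdmissible-windowLocal m G)) G-admissible))
  where
  G = translate X y₁ y₂
  G-admissible = admissible⇒locallyAdmissible adm y₁ y₂

-- Upper bounds

outflow inflow : Subset → ℕ
outflow G = sum (map (λ (d₁ , d₂) → indicator (G 0ℤ 0ℤ ∧ not (G d₁ d₂))) offsets)
inflow  G = sum (map (λ (d₁ , d₂) → indicator (not (G 0ℤ 0ℤ) ∧ G (ℤ.- d₁) (ℤ.- d₂))) offsets)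

-- Each point of G starts with charge c and sends one unit to each neighbour outside G;
-- balanced says that the final charge at the origin is at most K.
balanced : ℕ → ℕ → Subset → Bool
balanced c K G = c * indicator (G 0ℤ 0ℤ) + inflow G ≤ᵇ K + outflow G

balanced-windowLocal : ∀ c K → WindowLocal (balanced c K)
balanced-windowLocal c K G = refl

sends receives : Subset → ℤ × ℤ → ℤ → ℤ → ℕ
sends    X (d₁ , d₂) x y = indicator (X x y ∧ not (X (x ℤ.+ d₁) (y ℤ.+ d₂)))
receives X (d₁ , d₂) x y = sends X (d₁ , d₂) (x ℤ.- d₁) (y ℤ.- d₂)

translate-origin : ∀ X x y → translate X x y 0ℤ 0ℤ ≡ X x y
translate-origin X x y = cong₂ X (ℤ.+-identityʳ x) (ℤ.+-identityʳ y)

outflow-translate : ∀ X x y → outflow (translate X x y) ≡ sum (map (λ d → sends X d x y) offsets)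
outflow-translate X x y = cong sum (map-cong (λ (d₁ , d₂) →
  cong (λ b → indicator (b ∧ not (X (x ℤ.+ d₁) (y ℤ.+ d₂)))) (translate-origin X x y)) offsets)

inflow-translate : ∀ X x y → inflow (translate X x y) ≡ sum (map (λ d → receives X d x y) offsets)
inflow-translate X x y = cong sum (map-cong received-from offsets)
  where
  received-from : ∀ ((d₁ , d₂) : ℤ × ℤ) →
                  indicator (not (translate X x y 0ℤ 0ℤ) ∧ X (x ℤ.- d₁) (y ℤ.- d₂)) ≡ receives X (d₁ , d₂) x y
  received-from (d₁ , d₂) = cong indicator (trans (∧-comm (not (translate X x y 0ℤ 0ℤ)) (X (x ℤ.- d₁) (y ℤ.- d₂)))
    (cong (λ b → X (x ℤ.- d₁) (y ℤ.- d₂) ∧ not b)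
          (trans (translate-origin X x y) (sym (cong₂ X (x-d+d≡x x d₁) (x-d+d≡x y d₂))))))

offsets-norm≤2 : All (λ d → ℤ.∣ ℤ.- proj₁ d ∣ + ℤ.∣ ℤ.- proj₂ d ∣ ≤ 2) offsets
offsets-norm≤2 = from-yes (All.all? (λ d → ℤ.∣ ℤ.- proj₁ d ∣ + ℤ.∣ ℤ.- proj₂ d ∣ ℕ.≤? 2) offsets)

boxSum-sent≤received : ∀ X k → sum (map (λ d → boxSum k (sends X d)) offsets)
                               ≤ sum (map (λ d → boxSum k (receives X d)) offsets) + 16 * side k
boxSum-sent≤received X k = begin
  sum (map (λ d → boxSum k (sends X d)) offsets)
    ≤⟨ sum-map-mono (All.map (λ {d} → sent≤received {d}) offsets-norm≤2) ⟩
  sum (map (λ d → boxSum k (receives X d) + 2 * side k) offsets)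
    ≡⟨ sum-map-distrib-+ (λ d → boxSum k (receives X d)) (λ _ → 2 * side k) offsets ⟩
  Received + sum (map (λ _ → 2 * side k) offsets)
    ≡⟨ cong (Received +_) (sum-map-const (2 * side k) offsets) ⟩
  Received + 8 * (2 * side k)
    ≡⟨ cong (Received +_) (*-assoc 8 2 (side k)) ⟨
  Received + 16 * side k ∎
  where
  open ≤-Reasoning
  Received = sum (map (λ d → boxSum k (receives X d)) offsets)
  sent≤received : ∀ {d} → ℤ.∣ ℤ.- proj₁ d ∣ + ℤ.∣ ℤ.- proj₂ d ∣ ≤ 2 →
                  boxSum k (sends X d) ≤ boxSum k (receives X d) + 2 * side k
  sent≤received {d₁ , d₂} norm≤2 = begin
    boxSum k (sends X d)                                  ≤⟨ m≤n+∣m-n∣ (boxSum k (sends X d)) (boxSum k (receives X d)) ⟩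
    boxSum k (receives X d) + ∣ boxSum k (sends X d) - boxSum k (receives X d) ∣
      ≡⟨ cong (boxSum k (receives X d) +_) (∣-∣-comm (boxSum k (sends X d)) (boxSum k (receives X d))) ⟩
    boxSum k (receives X d) + ∣ boxSum k (receives X d) - boxSum k (sends X d) ∣
      ≤⟨ +-monoʳ-≤ _ (boxSum-shift k {sends X d} (λ x y → indicator≤1 _) (ℤ.- d₁) (ℤ.- d₂)) ⟩
    boxSum k (receives X d) + (ℤ.∣ ℤ.- d₁ ∣ + ℤ.∣ ℤ.- d₂ ∣) * (side k * 1)
      ≤⟨ +-monoʳ-≤ _ (*-mono-≤ norm≤2 (≤-reflexive (*-identityʳ (side k)))) ⟩
    boxSum k (receives X d) + 2 * side k ∎
    where d = (d₁ , d₂)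

discharging : ∀ c K X → (∀ y₁ y₂ → T (balanced c K (translate X y₁ y₂))) →
              ∀ k → c * count X k ≤ K * (side k * side k) + 16 * side k
discharging c K X balanced-everywhere k = +-cancelʳ-≤ Received _ _ (begin
  c * count X k + Received
    ≡⟨ cong₂ _+_ (trans (cong (c *_) (count≡boxSum X k)) (*-distribˡ-boxSum k c (λ x y → indicator (X x y))))
                 (sym (boxSum-sum k offsets (receives X))) ⟩
  boxSum k (λ x y → c * indicator (X x y)) + boxSum k received
    ≡⟨ trans (sym (boxSum-distrib-+ k (λ x y → c * indicator (X x y)) received)) (boxSum-cong k (λ x y → sym (charge≡ x y))) ⟩
  boxSum k charge
    ≤⟨ boxSum-mono k {charge} {bound} (λ x y → ≤ᵇ⇒≤ (charge x y) (bound x y) (balanced-everywhere x y)) ⟩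
  boxSum k bound
    ≡⟨ trans (boxSum-distrib-+ k (λ _ _ → K) (λ x y → outflow (translate X x y)))
             (cong₂ _+_ (boxSum-const k K) (trans (boxSum-cong k (outflow-translate X)) (boxSum-sum k offsets (sends X)))) ⟩
  K * (side k * side k) + sum (map (λ d → boxSum k (sends X d)) offsets)
    ≤⟨ +-monoʳ-≤ (K * (side k * side k)) (boxSum-sent≤received X k) ⟩
  K * (side k * side k) + (Received + 16 * side k)
    ≡⟨ regroup (K * (side k * side k)) Received (16 * side k) ⟩
  K * (side k * side k) + 16 * side k + Received ∎)
  where
  open ≤-Reasoning
  Received = sum (map (λ d → boxSum k (receives X d)) offsets)
  charge bound : ℤ → ℤ → ℕ
  charge x y = c * indicator (translate X x y 0ℤ 0ℤ) + inflow (translate X x y)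
  bound  x y = K + outflow (translate X x y)
  received : ℤ → ℤ → ℕ
  received x y = sum (map (λ d → receives X d x y) offsets)
  charge≡ : ∀ x y → charge x y ≡ c * indicator (X x y) + received x y
  charge≡ x y = cong₂ _+_ (cong (λ b → c * indicator b) (translate-origin X x y)) (inflow-translate X x y)
  regroup : ∀ a b c → a + (b + c) ≡ a + c + b
  regroup = solve-∀

discharging-bound : ∀ {m} c K → WindowCheck m (balanced c K) →
                    ∀ X → Admissible m X → ∀ k → c * count X k ≤ K * (side k * side k) + 16 * side k
discharging-bound c K check X adm = discharging c K X (windowCheck-sound (balanced c K) (balanced-windowLocal c K) check adm)

sparse : Subset → Bool
sparse G = windowCount 2 2 G ≤ᵇ 1

sparse-bound : WindowCheck 0 sparse → ∀ X → Admissible 0 X → ∀ k →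
               2 * 2 * count X k ≤ 1 * (side k * side k) + 2 * (2 * (2 + 2)) * side k
sparse-bound check X adm k = count-upper 2 2 X k (λ x y → ≤ᵇ⇒≤ _ 1 (windowCheck-sound sparse (λ G → refl) check adm x y))

-- From counts to densities

toℚᵘ-/ : ∀ n d → toℚᵘ (ℤ.+ n / suc d) ℚᵘ.≃ mkℚᵘ (ℤ.+ n) d
toℚᵘ-/ n d = ℚ.toℚᵘ-fromℚᵘ (mkℚᵘ (ℤ.+ n) d)

p*s≤r*q⇒p/q≤r/s : ∀ p q r s .{{_ : NonZero q}} .{{_ : NonZero s}} → p * s ≤ r * q → ℤ.+ p / q ℚ.≤ ℤ.+ r / s
p*s≤r*q⇒p/q≤r/s p (suc q) r (suc s) ps≤rq =
  ℚ.toℚᵘ-cancel-≤ (ℚᵘ.≤-respˡ-≃ (ℚᵘ.≃-sym (toℚᵘ-/ p q))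
                  (ℚᵘ.≤-respʳ-≃ (ℚᵘ.≃-sym (toℚᵘ-/ r s)) (*≤* cross)))
  where
  cross : ℤ.+ p ℤ.* ℤ.+ suc s ℤ.≤ ℤ.+ r ℤ.* ℤ.+ suc q
  cross = subst₂ ℤ._≤_ (ℤ.pos-* p (suc s)) (ℤ.pos-* r (suc q)) (ℤ.+≤+ ps≤rq)

p/q+r/s≡ : ∀ p q r s .{{_ : NonZero q}} .{{_ : NonZero s}} →
           ℤ.+ p / q ℚ.+ ℤ.+ r / s ≡ (ℤ.+ (p * s + r * q) / (q * s)) {{m*n≢0 q s}}
p/q+r/s≡ p (suc q) r (suc s) = ℚ.toℚᵘ-injective (ℚᵘ.≃-trans (ℚ.toℚᵘ-homo-+ (ℤ.+ p / suc q) (ℤ.+ r / suc s))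
  (ℚᵘ.≃-trans (ℚᵘ.+-cong (toℚᵘ-/ p q) (toℚᵘ-/ r s))
  (ℚᵘ.≃-trans (ℚᵘ.≃-reflexive (cong (λ n → mkℚᵘ n _) numerator)) (ℚᵘ.≃-sym (toℚᵘ-/ _ _)))))
  where
  numerator : ℤ.+ p ℤ.* ℤ.+ suc s ℤ.+ ℤ.+ r ℤ.* ℤ.+ suc q ≡ ℤ.+ (p * suc s + r * suc q)
  numerator = sym (trans (ℤ.pos-+ (p * suc s) (r * suc q)) (cong₂ ℤ._+_ (ℤ.pos-* p (suc s)) (ℤ.pos-* r (suc q))))

k≤side : ∀ k → k ≤ side k
k≤side k = ≤-trans (m≤m+n k (k + 0)) (n≤1+n (2 * k))

upper-cross : ∀ {C K E e F cnt s} → C * cnt ≤ K * (s * s) + E * s → F * E ≤ s → 1 ≤ e * C →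
              cnt * (C * F) ≤ (K * F + e * C) * (s * s)
upper-cross {C} {K} {E} {e} {F} {cnt} {s} bound FE≤s 1≤eC = begin
  cnt * (C * F)                         ≡⟨ eq₁ cnt C F ⟩
  F * (C * cnt)                         ≤⟨ *-monoʳ-≤ F bound ⟩
  F * (K * (s * s) + E * s)             ≡⟨ eq₂ F K E s ⟩
  K * F * (s * s) + F * E * s           ≤⟨ +-monoʳ-≤ (K * F * (s * s)) (*-monoˡ-≤ s FE≤s) ⟩
  K * F * (s * s) + s * s               ≡⟨ cong (K * F * (s * s) +_) (*-identityˡ (s * s)) ⟨
  K * F * (s * s) + 1 * (s * s)         ≤⟨ +-monoʳ-≤ (K * F * (s * s)) (*-monoˡ-≤ (s * s) 1≤eC) ⟩
  K * F * (s * s) + e * C * (s * s)     ≡⟨ *-distribʳ-+ (s * s) (K * F) (e * C) ⟨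
  (K * F + e * C) * (s * s)             ∎
  where
  open ≤-Reasoning
  eq₁ : ∀ cnt C F → cnt * (C * F) ≡ F * (C * cnt)
  eq₁ = solve-∀
  eq₂ : ∀ F K E s → F * (K * (s * s) + E * s) ≡ K * F * (s * s) + F * E * s
  eq₂ = solve-∀

upperDensity≤-from-count : ∀ {C K E} T .{{_ : NonZero C}} →
                           (∀ k → C * count T k ≤ K * (side k * side k) + E * side k) → UpperDensity≤ T (ℤ.+ K / C)
upperDensity≤-from-count T _ (mkℚ -[1+ _ ] _ _)   ()
upperDensity≤-from-count T _ (mkℚ (ℤ.+ zero) _ _) ()
upperDensity≤-from-count {C} {K} {E} T bound ε@(mkℚ (ℤ.+ suc e-1) f-1 _) _ = E * F , below
  where
  e = suc e-1
  F = suc f-1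
  1≤eC : 1 ≤ e * C
  1≤eC = ≤-trans (s≤s (z≤n {e-1})) (m≤m*n e C)
  below : ∀ k → E * F ≤ k → density T k ℚ.≤ ℤ.+ K / C ℚ.+ ε
  below k E*F≤k = begin
    density T k
      ≤⟨ p*s≤r*q⇒p/q≤r/s (count T k) (side k * side k) (K * F + e * C) (C * F) {{_}} {{m*n≢0 C F}}
           (upper-cross {C} {K} {E} {e} {F} (bound k) FE≤side 1≤eC) ⟩
    (ℤ.+ (K * F + e * C) / (C * F)) {{m*n≢0 C F}}
      ≡⟨ p/q+r/s≡ K C e F ⟨
    ℤ.+ K / C ℚ.+ ℤ.+ e / F
      ≡⟨ cong (ℤ.+ K / C ℚ.+_) (ℚ.↥p/↧p≡p ε) ⟩
    ℤ.+ K / C ℚ.+ ε ∎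
    where
    open ℚ.≤-Reasoning
    FE≤side : F * E ≤ side k
    FE≤side = ≤-trans (≤-reflexive (*-comm F E)) (≤-trans E*F≤k (k≤side k))

lower-cross : ∀ {A C K c₀ E cnt s} → c₀ * (s * s) ≤ A * cnt + E * s → K * A < c₀ * C → 2 * C * E ≤ s →
              (K * (2 * A * C) + 1 * C) * (s * s) ≤ cnt * (C * (2 * A * C))
lower-cross {A} {C} {K} {c₀} {E} {cnt} {s} bound KA<c₀C 2CE≤s = +-cancelʳ-≤ (C * (2 * C * E * s)) _ _ (begin
  L + C * (2 * C * E * s)                ≤⟨ +-monoʳ-≤ L (*-monoʳ-≤ C (*-monoˡ-≤ s 2CE≤s)) ⟩
  L + C * (s * s)                        ≡⟨ eq₁ K A C s ⟩
  2 * C * ((1 + K * A) * (s * s))        ≤⟨ *-monoʳ-≤ (2 * C) (*-monoˡ-≤ (s * s) KA<c₀C) ⟩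
  2 * C * (c₀ * C * (s * s))             ≡⟨ eq₂ C c₀ s ⟩
  2 * C * C * (c₀ * (s * s))             ≤⟨ *-monoʳ-≤ (2 * C * C) bound ⟩
  2 * C * C * (A * cnt + E * s)          ≡⟨ eq₃ C A cnt E s ⟩
  cnt * (C * (2 * A * C)) + C * (2 * C * E * s) ∎)
  where
  open ≤-Reasoning
  L = (K * (2 * A * C) + 1 * C) * (s * s)
  eq₁ : ∀ K A C s → (K * (2 * A * C) + 1 * C) * (s * s) + C * (s * s) ≡ 2 * C * ((1 + K * A) * (s * s))
  eq₁ = solve-∀
  eq₂ : ∀ C c₀ s → 2 * C * (c₀ * C * (s * s)) ≡ 2 * C * C * (c₀ * (s * s))
  eq₂ = solve-∀
  eq₃ : ∀ C A cnt E s → 2 * C * C * (A * cnt + E * s) ≡ cnt * (C * (2 * A * C)) + C * (2 * C * E * s)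
  eq₃ = solve-∀

-- ε = 1/(2AC) is half of the gap c₀/A - K/C ≥ 1/(AC); the other half absorbs the boundary term
-- E/(A·side) once side ≥ 2CE.
upperDensity>-from-count : ∀ {A C K c₀ E} S .{{_ : NonZero A}} .{{_ : NonZero C}} →
                           (∀ k → c₀ * (side k * side k) ≤ A * count S k + E * side k) → K * A < c₀ * C →
                           UpperDensity> S (ℤ.+ K / C)
upperDensity>-from-count {A} {C} {K} {c₀} {E} S bound KA<c₀C =
  ℤ.+ 1 / D , ℚ.normalize-pos 1 D , λ R → R + 2 * C * E , m≤m+n R _ , above (R + 2 * C * E) (m≤n+m _ R)
  where
  D = 2 * A * C
  instance
    D≢0 : NonZero D
    D≢0 = m*n≢0 (2 * A) C {{m*n≢0 2 A}}
  above : ∀ k → 2 * C * E ≤ k → ℤ.+ K / C ℚ.+ ℤ.+ 1 / D ℚ.≤ density S k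
  above k 2CE≤k = begin
    ℤ.+ K / C ℚ.+ ℤ.+ 1 / D
      ≡⟨ p/q+r/s≡ K C 1 D ⟩
    (ℤ.+ (K * D + 1 * C) / (C * D)) {{m*n≢0 C D}}
      ≤⟨ p*s≤r*q⇒p/q≤r/s (K * D + 1 * C) (C * D) (count S k) (side k * side k) {{m*n≢0 C D}}
           (lower-cross {A} {C} {K} {c₀} {E} (bound k) KA<c₀C (≤-trans 2CE≤k (k≤side k))) ⟩
    density S k ∎
    where open ℚ.≤-Reasoning

-- Periodic sets

module _ {n : ℕ} where
  open import Function.Endo.Propositional (Fin (suc n)) using (_^_)

  prev : Fin (suc n) → Fin (suc n)
  prev zero    = fromℕ n
  prev (suc i) = inject₁ i

  next : Fin (suc n) → Fin (suc n)
  next i with n ℕ.≟ toℕ i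
  ... | yes _   = zero
  ... | no  n≢i = suc (lower₁ i n≢i)

  next-prev : ∀ i → next (prev i) ≡ i
  next-prev zero with n ℕ.≟ toℕ (fromℕ n)
  ... | yes _   = refl
  ... | no  n≢n = contradiction (sym (toℕ-fromℕ n)) n≢n
  next-prev (suc i) with n ℕ.≟ toℕ (inject₁ i)
  ... | yes n≡i = contradiction n≡i (toℕ-inject₁-≢ i)
  ... | no  n≢i = cong suc (lower₁-inject₁′ i n≢i)

  prev-next : ∀ i → prev (next i) ≡ i
  prev-next i with n ℕ.≟ toℕ i
  ... | yes n≡i = toℕ-injective (trans (toℕ-fromℕ n) n≡i)
  ... | no  n≢i = inject₁-lower₁ i n≢i

  rotate : ℤ → Fin (suc n) → Fin (suc n)
  rotate (ℤ.+ u)  = next ^ u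
  rotate -[1+ u ] = prev ^ suc u

  rotate-+1 : ∀ x i → rotate (x ℤ.+ ℤ.1ℤ) i ≡ next (rotate x i)
  rotate-+1 (ℤ.+ u)        i = cong (λ m → (next ^ m) i) (+-comm u 1)
  rotate-+1 -[1+ zero ]    i = sym (next-prev i)
  rotate-+1 -[1+ suc u ]   i = sym (next-prev _)

  rotate-+-1 : ∀ x i → rotate (x ℤ.+ ℤ.-1ℤ) i ≡ prev (rotate x i)
  rotate-+-1 x i = trans (sym (prev-next _))
    (cong prev (trans (sym (rotate-+1 (x ℤ.+ ℤ.-1ℤ) i)) (cong (λ z → rotate z i) (x-d+d≡x x ℤ.1ℤ))))

  rotate-+ : ∀ x d i → rotate (x ℤ.+ d) i ≡ rotate d (rotate x i)
  rotate-+ x (ℤ.+ zero)     i = cong (λ z → rotate z i) (ℤ.+-identityʳ x)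
  rotate-+ x (ℤ.+ suc u)    i = begin
    rotate (x ℤ.+ ℤ.+ suc u) i            ≡⟨ cong (λ m → rotate (x ℤ.+ ℤ.+ m) i) (+-comm 1 u) ⟩
    rotate (x ℤ.+ (ℤ.+ u ℤ.+ ℤ.1ℤ)) i     ≡⟨ cong (λ z → rotate z i) (ℤ.+-assoc x (ℤ.+ u) ℤ.1ℤ) ⟨
    rotate (x ℤ.+ ℤ.+ u ℤ.+ ℤ.1ℤ) i       ≡⟨ rotate-+1 (x ℤ.+ ℤ.+ u) i ⟩
    next (rotate (x ℤ.+ ℤ.+ u) i)         ≡⟨ cong next (rotate-+ x (ℤ.+ u) i) ⟩
    rotate (ℤ.+ suc u) (rotate x i)       ∎
    where open ≡-Reasoning
  rotate-+ x -[1+ zero ]    i = rotate-+-1 x i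
  rotate-+ x -[1+ suc u ]   i = begin
    rotate (x ℤ.+ -[1+ suc u ]) i         ≡⟨ cong (λ m → rotate (x ℤ.+ -[1+ suc m ]) i) (+-identityʳ u) ⟨
    rotate (x ℤ.+ (-[1+ u ] ℤ.+ ℤ.-1ℤ)) i ≡⟨ cong (λ z → rotate z i) (ℤ.+-assoc x -[1+ u ] ℤ.-1ℤ) ⟨
    rotate (x ℤ.+ -[1+ u ] ℤ.+ ℤ.-1ℤ) i   ≡⟨ rotate-+-1 (x ℤ.+ -[1+ u ]) i ⟩
    prev (rotate (x ℤ.+ -[1+ u ]) i)      ≡⟨ cong prev (rotate-+ x -[1+ u ] i) ⟩
    rotate -[1+ suc u ] (rotate x i)      ∎
    where open ≡-Reasoning

  wrap : ℤ → Fin (suc n)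
  wrap x = rotate x zero

module _ {p q : ℕ} (P : Fin (suc p) → Fin (suc q) → Bool) where

  periodic : Subset
  periodic x y = P (wrap x) (wrap y)

  seenFrom : Fin (suc p) → Fin (suc q) → Subset
  seenFrom r₁ r₂ u v = P (rotate u r₁) (rotate v r₂)

  translate-periodic : ∀ x y u v → translate periodic x y u v ≡ seenFrom (wrap x) (wrap y) u v
  translate-periodic x y u v = cong₂ P (rotate-+ x u zero) (rotate-+ y v zero)

  periodic-admissible : ∀ {m} → (∀ r₁ r₂ → T (P r₁ r₂) → N (seenFrom r₁ r₂) 0ℤ 0ℤ ≤ m) → Admissible m periodic
  periodic-admissible {m} admissible-seen x y xy∈ = begin
    N periodic x y                         ≡⟨ cong₂ (N periodic) (ℤ.+-identityʳ x) (ℤ.+-identityʳ y) ⟨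
    N periodic (x ℤ.+ 0ℤ) (y ℤ.+ 0ℤ)       ≡⟨ N-translate periodic x y 0ℤ 0ℤ ⟨
    N (translate periodic x y) 0ℤ 0ℤ       ≡⟨ N-cong (translate-periodic x y) 0ℤ 0ℤ ⟩
    N (seenFrom (wrap x) (wrap y)) 0ℤ 0ℤ   ≤⟨ admissible-seen (wrap x) (wrap y) (Equivalence.from T-≡ xy∈) ⟩
    m                                      ∎
    where open ≤-Reasoning

  periodic-dense : ∀ {a b c₀} → (∀ r₁ r₂ → c₀ ≤ windowCount a b (seenFrom r₁ r₂)) →
                   ∀ x y → c₀ ≤ windowCount a b (translate periodic x y)
  periodic-dense {a} {b} dense-seen x y =
    ≤-trans (dense-seen (wrap x) (wrap y)) (≤-reflexive (windowCount-cong a b (λ u v → sym (translate-periodic x y u v))))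

  periodicAdmissible? : ∀ m → Dec (∀ r₁ r₂ → T (P r₁ r₂) → N (seenFrom r₁ r₂) 0ℤ 0ℤ ≤ m)
  periodicAdmissible? m = all? λ r₁ → all? λ r₂ → T? (P r₁ r₂) →-dec (N (seenFrom r₁ r₂) 0ℤ 0ℤ ≤? m)

  periodicDense? : ∀ a b c₀ → Dec (∀ r₁ r₂ → c₀ ≤ windowCount a b (seenFrom r₁ r₂))
  periodicDense? a b c₀ = all? λ r₁ → all? λ r₂ → c₀ ≤? windowCount a b (seenFrom r₁ r₂)

δ>δ-from-periodic : ∀ {n m p q} (P : Fin (suc p) → Fin (suc q) → Bool) {a b c₀ K C E}
                    .{{_ : NonZero (a * b)}} .{{_ : NonZero C}} →
                    (∀ r₁ r₂ → T (P r₁ r₂) → N (seenFrom P r₁ r₂) 0ℤ 0ℤ ≤ n) →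
                    (∀ r₁ r₂ → c₀ ≤ windowCount a b (seenFrom P r₁ r₂)) →
                    K * (a * b) < c₀ * C →
                    (∀ X → Admissible m X → ∀ k → C * count X k ≤ K * (side k * side k) + E * side k) →
                    δ>δ n m
δ>δ-from-periodic P {a} {b} {c₀} {K} {C} {E} admissible dense gap upper =
  ℤ.+ K / C ,
  (periodic P , periodic-admissible P admissible ,
   upperDensity>-from-count {a * b} {C} {K} {c₀} {a * (b * (a + b))} (periodic P)
     (λ k → count-lower a b (periodic P) k (periodic-dense P {a} {b} dense)) gap) ,
  λ X adm → upperDensity≤-from-count {C} {K} {E} X (upper X adm)

table : ∀ {p q} → Vec (Vec Bool (suc q)) (suc p) → Fin (suc p) → Fin (suc q) → Bool
table rows r₁ r₂ = lookup (lookup rows r₁) r₂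

pattern ■ = true
pattern □ = false

δ₁>δ₀ : δ>δ 1 0
δ₁>δ₀ = δ>δ-from-periodic P {a = 3} {b = 2} {c₀ = 2} {K = 1} {C = 4} {E = 16}
  (from-yes (periodicAdmissible? P 1)) (from-yes (periodicDense? P 3 2 2)) (from-yes (1 * (3 * 2) <? 2 * 4))
  (sparse-bound (from-yes (windowCheck? 0 sparse)))
  where
  P = table ((■ ∷ □ ∷ []) ∷
             (■ ∷ □ ∷ []) ∷
             (□ ∷ □ ∷ []) ∷ [])

δ₂>δ₁ : δ>δ 2 1
δ₂>δ₁ = δ>δ-from-periodic P {a = 1} {b = 2} {c₀ = 1} {K = 4} {C = 11} {E = 16}
  (from-yes (periodicAdmissible? P 2)) (from-yes (periodicDense? P 1 2 1)) (from-yes (4 * (1 * 2) <? 1 * 11))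
  (discharging-bound 11 4 (from-yes (windowCheck? 1 (balanced 11 4))))
  where
  P = table ((■ ∷ □ ∷ []) ∷ [])

δ₄>δ₃ : δ>δ 4 3
δ₄>δ₃ = δ>δ-from-periodic P {a = 5} {b = 1} {c₀ = 3} {K = 6} {C = 11} {E = 16}
  (from-yes (periodicAdmissible? P 4)) (from-yes (periodicDense? P 5 1 3)) (from-yes (6 * (5 * 1) <? 3 * 11))
  (discharging-bound 11 6 (from-yes (windowCheck? 3 (balanced 11 6))))
  where
  P = table ((■ ∷ ■ ∷ □ ∷ ■ ∷ □ ∷ []) ∷
             (■ ∷ □ ∷ ■ ∷ ■ ∷ □ ∷ []) ∷
             (■ ∷ □ ∷ ■ ∷ □ ∷ ■ ∷ []) ∷
             (□ ∷ ■ ∷ ■ ∷ □ ∷ ■ ∷ []) ∷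
             (□ ∷ ■ ∷ □ ∷ ■ ∷ ■ ∷ []) ∷ [])

δ₅>δ₄ : δ>δ 5 4
δ₅>δ₄ = δ>δ-from-periodic P {a = 5} {b = 5} {c₀ = 17} {K = 8} {C = 12} {E = 16}
  (from-yes (periodicAdmissible? P 5)) (from-yes (periodicDense? P 5 5 17)) (from-yes (8 * (5 * 5) <? 17 * 12))
  (discharging-bound 12 8 (from-yes (windowCheck? 4 (balanced 12 8))))
  where
  P = table ((■ ∷ ■ ∷ ■ ∷ ■ ∷ ■ ∷ []) ∷
             (■ ∷ □ ∷ ■ ∷ □ ∷ □ ∷ []) ∷
             (■ ∷ □ ∷ ■ ∷ ■ ∷ ■ ∷ []) ∷
             (■ ∷ ■ ∷ ■ ∷ ■ ∷ □ ∷ []) ∷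
             (■ ∷ □ ∷ □ ∷ ■ ∷ □ ∷ []) ∷ [])

δ₆>δ₅ : δ>δ 6 5
δ₆>δ₅ = δ>δ-from-periodic P {a = 5} {b = 1} {c₀ = 4} {K = 8} {C = 11} {E = 16}
  (from-yes (periodicAdmissible? P 6)) (from-yes (periodicDense? P 5 1 4)) (from-yes (8 * (5 * 1) <? 4 * 11))
  (discharging-bound 11 8 (from-yes (windowCheck? 5 (balanced 11 8))))
  where
  P = table ((□ ∷ ■ ∷ ■ ∷ ■ ∷ ■ ∷ []) ∷
             (■ ∷ ■ ∷ □ ∷ ■ ∷ ■ ∷ []) ∷
             (■ ∷ ■ ∷ ■ ∷ ■ ∷ □ ∷ []) ∷
             (■ ∷ □ ∷ ■ ∷ ■ ∷ ■ ∷ []) ∷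
             (■ ∷ ■ ∷ ■ ∷ □ ∷ ■ ∷ []) ∷ [])

δ₇>δ₆ : δ>δ 7 6
δ₇>δ₆ = δ>δ-from-periodic P {a = 3} {b = 3} {c₀ = 8} {K = 8} {C = 10} {E = 16}
  (from-yes (periodicAdmissible? P 7)) (from-yes (periodicDense? P 3 3 8)) (from-yes (8 * (3 * 3) <? 8 * 10))
  (discharging-bound 10 8 (from-yes (windowCheck? 6 (balanced 10 8))))
  where
  P = table ((□ ∷ ■ ∷ ■ ∷ []) ∷
             (■ ∷ ■ ∷ ■ ∷ []) ∷
             (■ ∷ ■ ∷ ■ ∷ []) ∷ [])

δ₈>δ₇ : δ>δ 8 7
δ₈>δ₇ = δ>δ-from-periodic P {a = 1} {b = 1} {c₀ = 1} {K = 8} {C = 9} {E = 16}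
  (from-yes (periodicAdmissible? P 8)) (from-yes (periodicDense? P 1 1 1)) (from-yes (8 * (1 * 1) <? 1 * 9))
  (discharging-bound 9 8 (from-yes (windowCheck? 7 (balanced 9 8))))
  where
  P = table ((■ ∷ []) ∷ [])

mainTheorem8 : (n : ℕ) → 1 ≤ n → n ≤ 8 → n ≢ 3 → δ>δ n (n ∸ 1)
mainTheorem8 0 () _ _
mainTheorem8 1 _ _ _   = δ₁>δ₀
mainTheorem8 2 _ _ _   = δ₂>δ₁
mainTheorem8 3 _ _ 3≢3 = contradiction refl 3≢3
mainTheorem8 4 _ _ _   = δ₄>δ₃
mainTheorem8 5 _ _ _   = δ₅>δ₄
mainTheorem8 6 _ _ _   = δ₆>δ₅
mainTheorem8 7 _ _ _   = δ₇>δ₆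
mainTheorem8 8 _ _ _   = δ₈>δ₇
mainTheorem8 (suc (suc (suc (suc (suc (suc (suc (suc (suc n))))))))) _ 9+n≤8 _ =
  contradiction (m+n≤o⇒m≤o 9 9+n≤8) (from-no (9 ≤? 8))
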